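{- Let $\mathrm{LS}(n,k)$ denote the Legendre-Stirling numbers of the second kind. For every integer $n\geq 1$ and every integer $k\ge 0$, $$\mathrm{LS}(n,k)=\#\{Y_n\in\mathcal{CLS}_n \mid n_x(Y_n)=k\},$$ where $\mathcal{CLS}_n$ is the set of CLS-sequences of length $n$ and $n_x(Y_n)$ is the number of occurrences of the symbol $X$ in $Y_n$.
   Context: The Legendre-Stirling numbers of the second kind $\mathrm{LS}(n,k)$ ($n,k\ge 0$) are defined by the recurrence $\mathrm{LS}(n,k)=\mathrm{LS}(n-1,k-1)+k(k+1)\mathrm{LS}(n-1,k)$ with initial conditions $\mathrm{LS}(n,0)=\delta_{n,0}$ and $\mathrm{LS}(0,k)=\delta_{0,k}$. Equivalently, $x^n=\sum_{k=0}^n \mathrm{LS}(n,k)\prod_{i=0}^{k-1}(x-i(1+i))$. A CLS-sequence of length $n$ is a sequence $Y_n=(y_1,\dots,y_n)$ of symbols such that $y_1=X$ and, for each $k=1,\dots,n-1$, $y_{k+1}\in\{X\}\cup\{A_{i,j}: 1\le i,j\le n_x(Y_k),\ i\neq j\}\cup\{B_s,\overline{B}_s: 1\le s\le n_x(Y_k)\}$, where $Y_k=(y_1,\dots,y_k)$ and $n_x(Y_k)$ is the number of entries of $Y_k$ equal to the symbol $X$. Here $X$, $A_{i,j}$, $B_s$, $\overline{B}_s$ are pairwise distinct formal symbols. -}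

module Defs where

open import Data.Nat using (ℕ; zero; suc; _+_; _*_; _≤ᵇ_; _≡ᵇ_)
open import Data.Bool using (Bool; true; false; _∧_; not)
open import Data.List using (List; []; _∷_; length)

LS : ℕ → ℕ → ℕ
LS zero    zero    = 1
LS zero    (suc k) = 0
LS (suc n) zero    = 0
LS (suc n) (suc k) = LS n k + (suc k * suc (suc k)) * LS n (suc k)

data Sym : Set where
  X    : Sym
  A    : ℕ → ℕ → Sym
  B    : ℕ → Sym
  Bbar : ℕ → Sym

nx : List Sym → ℕ
nx []           = 0
nx (X ∷ ys)     = suc (nx ys)
nx (A _ _ ∷ ys) = nx ys
nx (B _ ∷ ys)   = nx ys
nx (Bbar _ ∷ ys) = nx ys

inRange : ℕ → ℕ → Bool
inRange c i = (1 ≤ᵇ i) ∧ (i ≤ᵇ c)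

-- validFrom c ys: every entry of ys is allowed, given that the prefix before it
-- contains exactly c (updated as we go) entries X.
validFrom : ℕ → List Sym → Bool
validFrom c []             = true
validFrom c (X ∷ ys)       = validFrom (suc c) ys
validFrom c (A i j ∷ ys)   = inRange c i ∧ inRange c j ∧ not (i ≡ᵇ j) ∧ validFrom c ys
validFrom c (B s ∷ ys)     = inRange c s ∧ validFrom c ys
validFrom c (Bbar s ∷ ys)  = inRange c s ∧ validFrom c ys

-- Y is a CLS-sequence (y_1 first in the list): y_1 = X and every later entry allowed.
isCLSseq : List Sym → Bool
isCLSseq []       = false
isCLSseq (X ∷ ys) = validFrom 1 ys
isCLSseq (_ ∷ ys) = false

isCLS : ℕ → List Sym → Bool
isCLS n Y = (length Y ≡ᵇ n) ∧ isCLSseq Y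

module Submission where

-- Read a CLS-sequence from left to right: after a prefix with c letters X the
-- next symbol is X or one of c(c-1) + 2c = c(c+1) other symbols A_{i,j}, B_s,
-- B̄_s. Classifying the extensions of such a prefix by their first symbol gives
-- a first-step recurrence for their number LSfrom c m k, while LS is defined by
-- a last-step recurrence; an induction on m shows that LSfrom obeys the
-- last-step recurrence too, so LS (n + 1) k = LSfrom 1 n k.

open import Defs
open import Data.Nat using (ℕ; _≤_; zero; suc; _+_; _*_; _≡ᵇ_)
open import Data.Nat.Properties using (≤⇒≤ᵇ; ≤ᵇ⇒≤; ≡ᵇ⇒≡; ≡⇒≡ᵇ; suc-injective; +-suc; +-identityʳ; *-zeroʳ; ≡-irrelevant)
open import Data.Nat.Solver using (module +-*-Solver)
open import Data.Fin using (Fin; zero; suc; toℕ; fromℕ<)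
open import Data.Fin.Properties using (toℕ<n; fromℕ<-toℕ; toℕ-fromℕ<; toℕ-injective; +↔⊎; *↔×)
  renaming (_≟_ to _≟ᶠ_)
open import Data.List using (List; []; _∷_; length)
open import Data.Bool using (Bool; false; T; _∧_; not)
open import Data.Bool.Properties using (T-∧; T-≡; T-not-≡; ¬-not; T-irrelevant; ∧-assoc)
open import Data.Product using (Σ; _×_; _,_)
open import Data.Sum using (_⊎_; inj₁; inj₂)
open import Data.Empty using (⊥-elim)
open import Function using (_∘_)
open import Relation.Nullary using (Dec; yes; no)
open import Relation.Binary.PropositionalEquality using (_≡_; _≢_; refl; sym; trans; cong; cong₂; subst; module ≡-Reasoning)
open import Function.Bundles using (_↔_; mk↔ₛ′; _⇔_; mk⇔; Equivalence)
open import Function.Construct.Composition using (_↔-∘_)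
open import Function.Construct.Symmetry using (↔-sym)
open import Data.Sum.Function.Propositional using (_⊎-↔_)
open import Data.Product.Function.NonDependent.Propositional using (_×-↔_)

δ : ℕ → ℕ → ℕ
δ zero    zero    = 1
δ zero    (suc k) = 0
δ (suc c) zero    = 0
δ (suc c) (suc k) = δ c k

*-δ : ∀ (f : ℕ → ℕ) c k → f c * δ c k ≡ f k * δ c k
*-δ f zero    zero    = refl
*-δ f zero    (suc k) = trans (*-zeroʳ (f 0)) (sym (*-zeroʳ (f (suc k))))
*-δ f (suc c) zero    = trans (*-zeroʳ (f (suc c))) (sym (*-zeroʳ (f 0)))
*-δ f (suc c) (suc k) = *-δ (f ∘ suc) c k

-- The number of ways to append m symbols to a valid prefix containing c letters
-- X so that k letters X occur in the end.
LSfrom : ℕ → ℕ → ℕ → ℕ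
LSfrom c zero    k = δ c k
LSfrom c (suc m) k = LSfrom (suc c) m k + c * suc c * LSfrom c m k

LSfrom-zero : ∀ m c → LSfrom (suc c) m 0 ≡ 0
LSfrom-zero zero    c = refl
LSfrom-zero (suc m) c =
  trans (cong₂ (λ u v → u + suc c * suc (suc c) * v) (LSfrom-zero m (suc c)) (LSfrom-zero m c))
        (*-zeroʳ (suc c * suc (suc c)))

open +-*-Solver using (solve; _:+_; _:*_; _:=_)

LSfrom-last-step : ∀ m c k →
  LSfrom c (suc m) (suc k) ≡ LSfrom c m k + suc k * suc (suc k) * LSfrom c m (suc k)
LSfrom-last-step zero    c k = cong (δ c k +_) (*-δ (λ i → i * suc i) c (suc k))
LSfrom-last-step (suc m) c k = begin
  LSfrom (suc c) (suc m) (suc k) + C * LSfrom c (suc m) (suc k)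
    ≡⟨ cong₂ (λ u v → u + C * v) (LSfrom-last-step m (suc c) k) (LSfrom-last-step m c k) ⟩
  (LSfrom (suc c) m k + K * LSfrom (suc c) m (suc k)) + C * (LSfrom c m k + K * LSfrom c m (suc k))
    ≡⟨ interchange (LSfrom (suc c) m k) (LSfrom c m k) (LSfrom (suc c) m (suc k)) (LSfrom c m (suc k)) C K ⟩
  LSfrom c (suc m) k + K * LSfrom c (suc m) (suc k) ∎
  where
  open ≡-Reasoning
  C = c * suc c
  K = suc k * suc (suc k)
  interchange : ∀ a b d e C K → (a + K * d) + C * (b + K * e) ≡ (a + C * b) + K * (d + C * e)
  interchange = solve 6 (λ a b d e C K →
    (a :+ K :* d) :+ C :* (b :+ K :* e) := (a :+ C :* b) :+ K :* (d :+ C :* e)) refl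

LS≡LSfrom : ∀ n k → LS (suc n) k ≡ LSfrom 1 n k
LS≡LSfrom zero    zero          = refl
LS≡LSfrom zero    (suc zero)    = refl
LS≡LSfrom zero    (suc (suc k)) = *-zeroʳ (suc (suc k) * suc (suc (suc k)))
LS≡LSfrom (suc n) zero          = sym (LSfrom-zero (suc n) 0)
LS≡LSfrom (suc n) (suc k)       =
  trans (cong₂ (λ u v → u + suc k * suc (suc k) * v) (LS≡LSfrom n k) (LS≡LSfrom n (suc k)))
        (sym (LSfrom-last-step n 1 k))

allowed : ℕ → Sym → Bool
allowed c X        = false
allowed c (A i j)  = inRange c i ∧ inRange c j ∧ not (i ≡ᵇ j)
allowed c (B s)    = inRange c s
allowed c (Bbar s) = inRange c s

Letter : ℕ → Set
Letter c = Σ Sym (T ∘ allowed c)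

Letter-≡ : ∀ {c y y'} → y ≡ y' → (p : T (allowed c y)) (q : T (allowed c y')) →
           _≡_ {A = Letter c} (y , p) (y' , q)
Letter-≡ refl p q = cong (_ ,_) (T-irrelevant p q)

inRange-suc-toℕ : ∀ {c} (s : Fin c) → T (inRange c (suc (toℕ s)))
inRange-suc-toℕ s = ≤⇒≤ᵇ (toℕ<n s)

fromIndex : ∀ {c} i → .(T (inRange c i)) → Fin c
fromIndex {c} (suc i) p = fromℕ< (≤ᵇ⇒≤ (suc i) c p)

suc-toℕ-fromIndex : ∀ {c} i .(p : T (inRange c i)) → suc (toℕ (fromIndex i p)) ≡ i
suc-toℕ-fromIndex (suc i) p = cong suc (toℕ-fromℕ< _)

fromIndex-suc-toℕ : ∀ {c} (s : Fin c) → fromIndex (suc (toℕ s)) (inRange-suc-toℕ s) ≡ s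
fromIndex-suc-toℕ s = fromℕ<-toℕ s _

≢⇒T-not-≡ᵇ : ∀ m n → m ≢ n → T (not (m ≡ᵇ n))
≢⇒T-not-≡ᵇ m n m≢n = Equivalence.from T-not-≡ (¬-not (m≢n ∘ ≡ᵇ⇒≡ m n ∘ Equivalence.from T-≡))

T-not-≡ᵇ⇒≢ : ∀ m n → T (not (m ≡ᵇ n)) → m ≢ n
T-not-≡ᵇ⇒≢ m n p m≡n = subst T (Equivalence.to T-not-≡ p) (≡⇒≡ᵇ m n m≡n)

allowed-A⇔ : ∀ c i j → T (allowed c (A i j)) ⇔ (T (inRange c i) × T (inRange c j) × i ≢ j)
allowed-A⇔ c i j = mk⇔
  (λ p → let (i∈ , q) = Equivalence.to T-∧ p; (j∈ , i≠j) = Equivalence.to T-∧ q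
         in i∈ , j∈ , T-not-≡ᵇ⇒≢ i j i≠j)
  (λ (i∈ , j∈ , i≢j) → Equivalence.from T-∧ (i∈ , Equivalence.from T-∧ (j∈ , ≢⇒T-not-≡ᵇ i j i≢j)))

-- With indices shifted to start at 1: (s, 0) ↦ B_s, (s, s + 1) ↦ B̄_s and
-- (s, t + 1) ↦ A_{s,t} for t ≠ s.
encodeLetter : ∀ {c} → Fin c × Fin (suc c) → Letter c
encodeLetter (s , zero) = B (suc (toℕ s)) , inRange-suc-toℕ s
encodeLetter {c} (s , suc t) with s ≟ᶠ t
... | yes _   = Bbar (suc (toℕ s)) , inRange-suc-toℕ s
... | no s≢t  = A (suc (toℕ s)) (suc (toℕ t)) ,
  Equivalence.from (allowed-A⇔ c _ _) (inRange-suc-toℕ s , inRange-suc-toℕ t , s≢t ∘ toℕ-injective ∘ suc-injective)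

decodeLetter : ∀ {c} → Letter c → Fin c × Fin (suc c)
decodeLetter (A i j , p) =
  let (i∈ , j∈ , _) = Equivalence.to (allowed-A⇔ _ i j) p in fromIndex i i∈ , suc (fromIndex j j∈)
decodeLetter (B s , p)    = fromIndex s p , zero
decodeLetter (Bbar s , p) = fromIndex s p , suc (fromIndex s p)

decode-encodeLetter : ∀ {c} (x : Fin c × Fin (suc c)) → decodeLetter (encodeLetter x) ≡ x
decode-encodeLetter (s , zero) = cong (_, zero) (fromIndex-suc-toℕ s)
decode-encodeLetter (s , suc t) with s ≟ᶠ t
... | yes refl = cong₂ _,_ (fromIndex-suc-toℕ s) (cong suc (fromIndex-suc-toℕ s))
... | no _     = cong₂ _,_ (fromIndex-suc-toℕ s) (cong suc (fromIndex-suc-toℕ t))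

encodeLetter-A : ∀ {c i j} (i∈ : T (inRange c i)) (j∈ : T (inRange c j)) → i ≢ j →
                 (p : T (allowed c (A i j))) →
                 encodeLetter (fromIndex i i∈ , suc (fromIndex j j∈)) ≡ (A i j , p)
encodeLetter-A {i = i} {j} i∈ j∈ i≢j p with fromIndex i i∈ ≟ᶠ fromIndex j j∈
... | yes e = ⊥-elim (i≢j (trans (sym (suc-toℕ-fromIndex i i∈))
                (trans (cong (suc ∘ toℕ) e) (suc-toℕ-fromIndex j j∈))))
... | no _  = Letter-≡ (cong₂ A (suc-toℕ-fromIndex i i∈) (suc-toℕ-fromIndex j j∈)) _ p

encode-decodeLetter : ∀ {c} (y : Letter c) → encodeLetter (decodeLetter y) ≡ y
encode-decodeLetter {c} (A i j , p) =
  let (i∈ , j∈ , i≢j) = Equivalence.to (allowed-A⇔ c i j) p in encodeLetter-A i∈ j∈ i≢j p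
encode-decodeLetter (B s , p) = Letter-≡ (cong B (suc-toℕ-fromIndex s p)) _ p
encode-decodeLetter (Bbar s , p) with fromIndex s p ≟ᶠ fromIndex s p
... | yes _  = Letter-≡ (cong Bbar (suc-toℕ-fromIndex s p)) _ p
... | no s≢s = ⊥-elim (s≢s refl)

Letter↔ : ∀ c → Fin (c * suc c) ↔ Letter c
Letter↔ c = mk↔ₛ′ encodeLetter decodeLetter encode-decodeLetter decode-encodeLetter ↔-∘ *↔× {c} {suc c}

IsExtension : ℕ → ℕ → ℕ → List Sym → Set
IsExtension c m k ys = T (validFrom c ys) × length ys ≡ m × c + nx ys ≡ k

Extension : ℕ → ℕ → ℕ → Set
Extension c m k = Σ (List Sym) (IsExtension c m k)

Extension-≡ : ∀ {c m k ys} (p q : IsExtension c m k ys) → _≡_ {A = Extension c m k} (ys , p) (ys , q)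
Extension-≡ (v , l , e) (v′ , l′ , e′) =
  cong (_ ,_) (cong₂ _,_ (T-irrelevant v v′) (cong₂ _,_ (≡-irrelevant l l′) (≡-irrelevant e e′)))

Fin-δ↔≡ : ∀ c k → Fin (δ c k) ↔ (c ≡ k)
Fin-δ↔≡ zero    zero    = mk↔ₛ′ (λ _ → refl) (λ _ → zero) (λ { refl → refl }) (λ { zero → refl ; (suc ()) })
Fin-δ↔≡ zero    (suc k) = mk↔ₛ′ (λ ()) (λ ()) (λ ()) (λ ())
Fin-δ↔≡ (suc c) zero    = mk↔ₛ′ (λ ()) (λ ()) (λ ()) (λ ())
Fin-δ↔≡ (suc c) (suc k) = mk↔ₛ′ (cong suc) suc-injective (λ _ → ≡-irrelevant _ _) (λ _ → ≡-irrelevant _ _)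
  ↔-∘ Fin-δ↔≡ c k

Extension-zero↔ : ∀ c k → Extension c 0 k ↔ (c ≡ k)
Extension-zero↔ c k = mk↔ₛ′ to from (λ _ → ≡-irrelevant _ _) from-to
  where
  to : Extension c 0 k → c ≡ k
  to ([] , _ , _ , e) = trans (sym (+-identityʳ c)) e
  from : c ≡ k → Extension c 0 k
  from c≡k = [] , _ , refl , trans (+-identityʳ c) c≡k
  from-to : ∀ y → from (to y) ≡ y
  from-to ([] , p) = Extension-≡ _ p

X? : (y : Sym) → Dec (y ≡ X)
X? X        = yes refl
X? (A _ _)  = no λ ()
X? (B _)    = no λ ()
X? (Bbar _) = no λ ()

allowed⇒≢X : ∀ {c} y → T (allowed c y) → y ≢ X
allowed⇒≢X X () refl

validFrom-letter : ∀ c y ys → y ≢ X → validFrom c (y ∷ ys) ≡ allowed c y ∧ validFrom c ys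
validFrom-letter c X        ys y≢X = ⊥-elim (y≢X refl)
validFrom-letter c (A i j)  ys _   =
  trans (cong (inRange c i ∧_) (sym (∧-assoc (inRange c j) (not (i ≡ᵇ j)) (validFrom c ys))))
        (sym (∧-assoc (inRange c i) (inRange c j ∧ not (i ≡ᵇ j)) (validFrom c ys)))
validFrom-letter c (B s)    ys _   = refl
validFrom-letter c (Bbar s) ys _   = refl

nx-letter : ∀ y ys → y ≢ X → nx (y ∷ ys) ≡ nx ys
nx-letter X        ys y≢X = ⊥-elim (y≢X refl)
nx-letter (A _ _)  ys _   = refl
nx-letter (B _)    ys _   = refl
nx-letter (Bbar _) ys _   = refl

Extension-suc↔ : ∀ c m k → Extension c (suc m) k ↔ (Extension (suc c) m k ⊎ (Letter c × Extension c m k))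
Extension-suc↔ c m k = mk↔ₛ′ to from to-from from-to
  where
  to : Extension c (suc m) k → Extension (suc c) m k ⊎ (Letter c × Extension c m k)
  to (y ∷ ys , v , l , e) with X? y
  ... | yes refl = inj₁ (ys , v , suc-injective l , trans (sym (+-suc c (nx ys))) e)
  ... | no y≢X   =
    let (y-ok , ys-ok) = Equivalence.to T-∧ (subst T (validFrom-letter c y ys y≢X) v)
    in inj₂ ((y , y-ok) , ys , ys-ok , suc-injective l , trans (cong (c +_) (sym (nx-letter y ys y≢X))) e)

  from : Extension (suc c) m k ⊎ (Letter c × Extension c m k) → Extension c (suc m) k
  from (inj₁ (ys , v , l , e)) = X ∷ ys , v , cong suc l , trans (+-suc c (nx ys)) e
  from (inj₂ ((y , y-ok) , ys , v , l , e)) =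
    y ∷ ys , subst T (sym (validFrom-letter c y ys y≢X)) (Equivalence.from T-∧ (y-ok , v)) ,
    cong suc l , trans (cong (c +_) (nx-letter y ys y≢X)) e
    where y≢X = allowed⇒≢X y y-ok

  from-to : ∀ y → from (to y) ≡ y
  from-to (y ∷ ys , p) with X? y
  ... | yes refl = Extension-≡ _ p
  ... | no _     = Extension-≡ _ p

  to-from : ∀ z → to (from z) ≡ z
  to-from (inj₁ (ys , p)) = cong inj₁ (Extension-≡ _ p)
  to-from (inj₂ ((y , y-ok) , ys , p)) with X? y
  ... | yes refl = ⊥-elim y-ok
  ... | no _     = cong inj₂ (cong₂ _,_ (Letter-≡ refl _ y-ok) (Extension-≡ _ p))

Fin-LSfrom↔Extension : ∀ m c k → Fin (LSfrom c m k) ↔ Extension c m k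
Fin-LSfrom↔Extension zero    c k = ↔-sym (Extension-zero↔ c k) ↔-∘ Fin-δ↔≡ c k
Fin-LSfrom↔Extension (suc m) c k =
  ↔-sym (Extension-suc↔ c m k) ↔-∘
  ((Fin-LSfrom↔Extension m (suc c) k ⊎-↔ ((Letter↔ c ×-↔ Fin-LSfrom↔Extension m c k) ↔-∘ *↔×)) ↔-∘
   +↔⊎)

CLS : ℕ → ℕ → Set
CLS n k = Σ (List Sym) (λ Y → T (isCLS n Y) × nx Y ≡ k)

isCLSseq-head : ∀ y ys → T (isCLSseq (y ∷ ys)) → y ≡ X
isCLSseq-head X _ _ = refl

CLS↔Extension : ∀ n k → CLS (suc n) k ↔ Extension 1 n k
CLS↔Extension n k = mk↔ₛ′ to from to-from from-to
  where
  from : Extension 1 n k → CLS (suc n) k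
  from (ys , v , l , e) = X ∷ ys , Equivalence.from T-∧ (≡⇒≡ᵇ _ _ l , v) , e

  to : CLS (suc n) k → Extension 1 n k
  to (y ∷ ys , p , e) with Equivalence.to T-∧ p
  ... | l , v with isCLSseq-head y ys v
  ...   | refl = ys , v , ≡ᵇ⇒≡ _ _ l , e

  from-to : ∀ Y → from (to Y) ≡ Y
  from-to (y ∷ ys , p , e) with Equivalence.to T-∧ p
  ... | l , v with isCLSseq-head y ys v
  ...   | refl = cong (λ q → X ∷ ys , q , e) (T-irrelevant _ p)

  to-from : ∀ z → to (from z) ≡ z
  to-from (ys , p) = Extension-≡ _ p

lemma1 : (n k : ℕ) → 1 ≤ n →
    Fin (LS n k) ↔ Σ (List Sym) (λ Y → T (isCLS n Y) × nx Y ≡ k)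
lemma1 (suc n) k _ rewrite LS≡LSfrom n k = ↔-sym (CLS↔Extension n k) ↔-∘ Fin-LSfrom↔Extension n 1 k
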